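{- Let $G$ and $G'$ be finite node-labeled digraphs that are weakly connected, simple and oriented, such that $S(G)\cong\Delta$ and $S(G')\cong Y$. Then $\mathcal L(G)\not\cong\mathcal L(G')$.
   Context: A node-labeled digraph $G=(V,\mathcal D,\ell_v)$ consists of a finite node set $V$, directed edges $\mathcal D\subseteq V\times V$, and a node-labeling function $\ell_v$. Weakly connected: underlying undirected graph connected. Simple: no self-loops and no parallel edges with the same source and target. Oriented: no pair $(u,v),(v,u)$ both in $\mathcal D$. The structure $S(G)$ is the unlabeled undirected graph on $V$ with edges $\{u,v\}$ for $(u,v)\in\mathcal D$. $Y$ is the undirected graph with nodes $a,b,c,d$ and edges $\{a,b\},\{a,c\},\{a,d\}$; $\Delta$ is the undirected triangle on $a,b,c$. Isomorphism of labeled digraphs: a node-label-preserving bijection of node sets with edges mapping to edges and non-edges to non-edges, preserving edge labels. The extended line digraph of $G$ is the labeled digraph $\mathcal L(G)=(\mathcal D,\mathcal D_L,\bar\ell_v,\bar\ell_e)$ with node set $\mathcal D$, node labels $\bar\ell_v((u,v))=(\ell_v(u),\ell_v(v))$, and, for distinct $e=(u,v),\hat e=(\hat u,\hat v)\in\mathcal D$: $(e,\hat e)\in\mathcal D_L$ labeled $ht$ iff $v=\hat u$; $(e,\hat e),(\hat e,e)\in\mathcal D_L$ labeled $tt$ iff $u=\hat u$; $(e,\hat e),(\hat e,e)\in\mathcal D_L$ labeled $hh$ iff $v=\hat v$. -}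

module Defs where

open import Data.Nat using (ℕ)
open import Data.Fin using (Fin; zero; suc)
open import Data.Bool using (Bool; true; false)
open import Data.Product using (Σ; _×_; _,_; proj₁; proj₂)
open import Data.Sum using (_⊎_)
open import Relation.Binary.PropositionalEquality using (_≡_; _≢_)
open import Relation.Nullary using (¬_)
open import Function.Bundles using (_↔_; Inverse)

-- Finite node-labeled digraphs G = (V, D, ℓ_v) with V = Fin n.
-- D ⊆ V × V is given by its (decidable) characteristic function.
-- Parallel edges with the same source and target are impossible in
-- this representation (D is a set of ordered pairs).

record NLDigraph (Lv : Set) : Set where
  field
    n    : ℕ
    edge : Fin n → Fin n → Bool
    ℓ    : Fin n → Lv

  Node : Set
  Node = Fin n

  _⇒_ : Node → Node → Set
  u ⇒ v = edge u v ≡ true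

  SAdj : Node → Node → Set
  SAdj u v = (u ⇒ v) ⊎ (v ⇒ u)

open NLDigraph public

data Reach {Lv : Set} (G : NLDigraph Lv) (u : Node G) : Node G → Set where
  here : Reach G u u
  step : ∀ {v w} → Reach G u v → SAdj G v w → Reach G u w

WeaklyConnected : {Lv : Set} → NLDigraph Lv → Set
WeaklyConnected G = ∀ (u v : Node G) → Reach G u v

-- simple: no self-loops (no parallel edges is built into the representation)
Simple : {Lv : Set} → NLDigraph Lv → Set
Simple G = ∀ (u : Node G) → ¬ (_⇒_ G u u)

Oriented : {Lv : Set} → NLDigraph Lv → Set
Oriented G = ∀ (u v : Node G) → ¬ (_⇒_ G u v × _⇒_ G v u)

record UGraph : Set₁ where
  field
    UV  : Set
    Adj : UV → UV → Set

open UGraph public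

S : {Lv : Set} → NLDigraph Lv → UGraph
S G = record { UV = Node G ; Adj = SAdj G }

_≅U_ : UGraph → UGraph → Set
H ≅U H' = Σ (UV H ↔ UV H') λ f →
  ∀ x y → (Adj H x y → Adj H' (Inverse.to f x) (Inverse.to f y))
        × (Adj H' (Inverse.to f x) (Inverse.to f y) → Adj H x y)

Δ : UGraph
Δ = record { UV = Fin 3 ; Adj = λ x y → x ≢ y }

Y : UGraph
Y = record { UV = Fin 4
           ; Adj = λ x y → (x ≡ zero × y ≢ zero) ⊎ (y ≡ zero × x ≢ zero) }

data ELab : Set where
  ht tt hh : ELab

record LDigraph (Ln Le : Set) : Set₁ where
  field
    LV    : Set
    lab   : LV → Ln
    LEdge : LV → LV → Le → Set

open LDigraph public

_≅L_ : {Ln Le : Set} → LDigraph Ln Le → LDigraph Ln Le → Set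
_≅L_ {Ln} {Le} H H' = Σ (LV H ↔ LV H') λ f →
  (∀ x → lab H' (Inverse.to f x) ≡ lab H x) ×
  (∀ x y (l : Le) → (LEdge H x y l → LEdge H' (Inverse.to f x) (Inverse.to f y) l)
                  × (LEdge H' (Inverse.to f x) (Inverse.to f y) l → LEdge H x y l))

Arc : {Lv : Set} → NLDigraph Lv → Set
Arc G = Σ (Node G × Node G) λ p → _⇒_ G (proj₁ p) (proj₂ p)

src tgt : {Lv : Set} {G : NLDigraph Lv} → Arc G → Node G
src e = proj₁ (proj₁ e)
tgt e = proj₂ (proj₁ e)

LineEdge : {Lv : Set} (G : NLDigraph Lv) → Arc G → Arc G → ELab → Set
LineEdge G e ê ht = proj₁ e ≢ proj₁ ê × tgt {G = G} e ≡ src {G = G} ê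
LineEdge G e ê tt = proj₁ e ≢ proj₁ ê × src {G = G} e ≡ src {G = G} ê
LineEdge G e ê hh = proj₁ e ≢ proj₁ ê × tgt {G = G} e ≡ tgt {G = G} ê

𝓛 : {Lv : Set} → NLDigraph Lv → LDigraph (Lv × Lv) ELab
𝓛 G = record
  { LV    = Arc G
  ; lab   = λ e → ℓ G (src {G = G} e) , ℓ G (tgt {G = G} e)
  ; LEdge = LineEdge G
  }

-- Whether L(G) has a tt-edge (two arcs with a common tail) or an hh-edge
-- (two arcs with a common head) is invariant under isomorphism. In a
-- triangle these two events coincide: from u → v and u → w the third side
-- joins v and w, and in either direction it closes a pair with a common
-- head; dually for a common head. In an oriented star with three leaves
-- exactly one of them happens: two of the three leaves are joined to the
-- centre in the same direction, and a common tail together with a common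
-- head would need four distinct leaves.
module Submission where

open import Defs
open import Relation.Nullary using (¬_)
import Data.Nat as ℕ
open import Data.Nat.Properties using (1+n≰n)
open import Data.Fin using (Fin; zero; suc; punchOut)
open import Data.Fin.Properties using (punchOut-injective; injective⇒≤)
open import Data.Vec using (Vec; []; _∷_)
open import Data.Vec.Relation.Unary.All using (All; []; _∷_)
open import Data.Vec.Relation.Unary.All.Properties using (lookup⁺)
open import Data.Vec.Relation.Unary.Unique.Propositional using (Unique; []; _∷_)
open import Data.Vec.Relation.Unary.Unique.Propositional.Properties using (lookup-injective)
open import Data.Product using (∃₂; _×_; _,_; proj₁; proj₂)
open import Data.Sum using (_⊎_; inj₁; inj₂)
open import Data.Empty using (⊥; ⊥-elim)
open import Function using (_∘_)
open import Function.Bundles using (_↔_; _⇔_; Inverse; Injection; Equivalence; mk⇔)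
open import Function.Construct.Composition using (_⇔-∘_)
open import Function.Construct.Symmetry using (⇔-sym)
open import Function.Definitions using (Injective)
open import Function.Properties.Inverse using (↔⇒↣; ↔-sym)
open import Relation.Binary.PropositionalEquality

↔-injective : {A B : Set} (f : A ↔ B) → Injective _≡_ _≡_ (Inverse.to f)
↔-injective f = Injection.injective (↔⇒↣ f)

unique-avoiding⇒length≤ : ∀ {k n} {xs : Vec (Fin (ℕ.suc n)) k} {i : Fin (ℕ.suc n)} →
                          Unique xs → All (i ≢_) xs → k ℕ.≤ n
unique-avoiding⇒length≤ {xs = xs} unique i∉xs = injective⇒≤ {f = squeeze} squeeze-injective
  where
  squeeze : Fin _ → Fin _
  squeeze j = punchOut (lookup⁺ i∉xs j)

  squeeze-injective : Injective _≡_ _≡_ squeeze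
  squeeze-injective {j} {j′} eq =
    lookup-injective unique j j′ (punchOut-injective (lookup⁺ i∉xs j) (lookup⁺ i∉xs j′) eq)

HasEdge : {Ln Le : Set} → LDigraph Ln Le → Le → Set
HasEdge H l = ∃₂ λ x y → LEdge H x y l

≅L⇒HasEdge⇔ : {Ln Le : Set} {H H′ : LDigraph Ln Le} → H ≅L H′ →
              (l : Le) → HasEdge H l ⇔ HasEdge H′ l
≅L⇒HasEdge⇔ {H = H} {H′} (f , _ , edges) l = mk⇔ forward backward
  where
  forward : HasEdge H l → HasEdge H′ l
  forward (x , y , e) = _ , _ , proj₁ (edges x y l) e

  backward : HasEdge H′ l → HasEdge H l
  backward (x , y , e) = _ , _ , proj₂ (edges _ _ l)
    (subst₂ (λ a b → LEdge H′ a b l)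
      (sym (Inverse.strictlyInverseˡ f x)) (sym (Inverse.strictlyInverseˡ f y)) e)

module _ {Lv : Set} (G : NLDigraph Lv) where

  infix 4 _↝_
  _↝_ : Node G → Node G → Set
  _↝_ = _⇒_ G

  out-fork : ∀ {u v w} → u ↝ v → u ↝ w → v ≢ w → HasEdge (𝓛 G) tt
  out-fork p q v≢w = (_ , p) , (_ , q) , v≢w ∘ cong proj₂ , refl

  in-fork : ∀ {u v w} → v ↝ u → w ↝ u → v ≢ w → HasEdge (𝓛 G) hh
  in-fork p q v≢w = (_ , p) , (_ , q) , v≢w ∘ cong proj₁ , refl

  arc-ends-distinct : Simple G → ∀ {u v} → u ↝ v → u ≢ v
  arc-ends-distinct simple p refl = simple _ p

  opposite-arcs-distinct : Oriented G → ∀ {u v x} → u ↝ v → x ↝ u → v ≢ x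
  opposite-arcs-distinct oriented {u} {v} p q refl = oriented u v (p , q)

  Complete : Set
  Complete = ∀ {v w} → v ≢ w → SAdj G v w

  module _ (simple : Simple G) (complete : Complete) where

    complete-out-fork⇒in-fork : HasEdge (𝓛 G) tt → HasEdge (𝓛 G) hh
    complete-out-fork⇒in-fork (((u , v) , p) , ((_ , w) , q) , uv≢uw , refl)
      with complete {v} {w} (uv≢uw ∘ cong (u ,_))
    ... | inj₁ v↝w = in-fork q v↝w (arc-ends-distinct simple p)
    ... | inj₂ w↝v = in-fork p w↝v (arc-ends-distinct simple q)

    complete-in-fork⇒out-fork : HasEdge (𝓛 G) hh → HasEdge (𝓛 G) tt
    complete-in-fork⇒out-fork (((v , u) , p) , ((w , _) , q) , vu≢wu , refl)
      with complete {v} {w} (vu≢wu ∘ cong (_, u))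
    ... | inj₁ v↝w = out-fork p v↝w (arc-ends-distinct simple q ∘ sym)
    ... | inj₂ w↝v = out-fork q w↝v (arc-ends-distinct simple p ∘ sym)

    complete-out-fork⇔in-fork : HasEdge (𝓛 G) tt ⇔ HasEdge (𝓛 G) hh
    complete-out-fork⇔in-fork = mk⇔ complete-out-fork⇒in-fork complete-in-fork⇒out-fork

  ≅Δ⇒complete : S G ≅U Δ → Complete
  ≅Δ⇒complete (f , adj) {v} {w} v≢w = proj₂ (adj v w) (v≢w ∘ ↔-injective f)

Y-common-neighbour-is-centre : ∀ {u v w} → Adj Y u v → Adj Y u w → v ≢ w →
                               u ≡ zero × v ≢ zero × w ≢ zero
Y-common-neighbour-is-centre (inj₁ (u≡0 , v≢0)) (inj₁ (_ , w≢0))    _   = u≡0 , v≢0 , w≢0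
Y-common-neighbour-is-centre (inj₁ (u≡0 , _))   (inj₂ (_ , u≢0))    _   = ⊥-elim (u≢0 u≡0)
Y-common-neighbour-is-centre (inj₂ (_ , u≢0))   (inj₁ (u≡0 , _))    _   = ⊥-elim (u≢0 u≡0)
Y-common-neighbour-is-centre (inj₂ (v≡0 , _))   (inj₂ (w≡0 , _))    v≢w = ⊥-elim (v≢w (trans v≡0 (sym w≡0)))

module _ {Lv : Set} (G : NLDigraph Lv) (iso : S G ≅U Y) where

  private
    to   = Inverse.to (proj₁ iso)
    from = Inverse.from (proj₁ iso)
    centre = from zero

    from-distinct : ∀ {i j} → i ≢ j → from i ≢ from j
    from-distinct i≢j = i≢j ∘ ↔-injective (↔-sym (proj₁ iso))

  to-adj : ∀ {u v} → SAdj G u v → Adj Y (to u) (to v)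
  to-adj {u} {v} = proj₁ (proj₂ iso u v)

  common-neighbour-is-centre : ∀ {u v w} → SAdj G u v → SAdj G u w → v ≢ w →
                               to u ≡ zero × to v ≢ zero × to w ≢ zero
  common-neighbour-is-centre uv uw v≢w =
    Y-common-neighbour-is-centre (to-adj uv) (to-adj uw) (v≢w ∘ ↔-injective (proj₁ iso))

  leaf-adj-centre : (k : Fin 4) → k ≢ zero → SAdj G centre (from k)
  leaf-adj-centre k k≢0 = proj₂ (proj₂ iso centre (from k))
    (inj₁ (Inverse.strictlyInverseˡ (proj₁ iso) zero ,
           k≢0 ∘ trans (sym (Inverse.strictlyInverseˡ (proj₁ iso) k))))

  star-has-fork : HasEdge (𝓛 G) tt ⊎ HasEdge (𝓛 G) hh
  star-has-fork
    with leaf-adj-centre (suc zero) (λ ())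
       | leaf-adj-centre (suc (suc zero)) (λ ())
       | leaf-adj-centre (suc (suc (suc zero))) (λ ())
  ... | inj₁ p | inj₁ q | _      = inj₁ (out-fork G p q (from-distinct λ ()))
  ... | inj₂ p | inj₂ q | _      = inj₂ (in-fork G p q (from-distinct λ ()))
  ... | inj₁ p | inj₂ _ | inj₁ r = inj₁ (out-fork G p r (from-distinct λ ()))
  ... | inj₁ _ | inj₂ q | inj₂ r = inj₂ (in-fork G q r (from-distinct λ ()))
  ... | inj₂ p | inj₁ _ | inj₂ r = inj₂ (in-fork G p r (from-distinct λ ()))
  ... | inj₂ _ | inj₁ q | inj₁ r = inj₁ (out-fork G q r (from-distinct λ ()))

  oriented-star-forks-exclusive : Oriented G → HasEdge (𝓛 G) tt → HasEdge (𝓛 G) hh → ⊥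
  oriented-star-forks-exclusive oriented
    (((u , v) , p) , ((_ , w) , q) , uv≢uw , refl)
    (((x , z) , r) , ((y , _) , s) , xz≢yz , refl)
    with common-neighbour-is-centre (inj₁ p) (inj₁ q) (uv≢uw ∘ cong (u ,_))
       | common-neighbour-is-centre (inj₂ r) (inj₂ s) (xz≢yz ∘ cong (_, z))
  ... | u↦0 , v≢0 , w≢0 | z↦0 , x≢0 , y≢0
    with ↔-injective (proj₁ iso) (trans u↦0 (sym z↦0))
  ... | refl = 1+n≰n (unique-avoiding⇒length≤ leaves-unique leaves-nonzero)
    where
    distinct : ∀ {a b} → a ≢ b → to a ≢ to b
    distinct a≢b = a≢b ∘ ↔-injective (proj₁ iso)

    opposite : ∀ {a b} → _⇒_ G u a → _⇒_ G b u → to a ≢ to b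
    opposite p′ q′ = distinct (opposite-arcs-distinct G oriented p′ q′)

    leaves-unique : Unique (to v ∷ to w ∷ to x ∷ to y ∷ [])
    leaves-unique =
      (distinct (uv≢uw ∘ cong (u ,_)) ∷ opposite p r ∷ opposite p s ∷ []) ∷
      (opposite q r ∷ opposite q s ∷ []) ∷
      (distinct (xz≢yz ∘ cong (_, u)) ∷ []) ∷
      [] ∷ []

    leaves-nonzero : All (zero ≢_) (to v ∷ to w ∷ to x ∷ to y ∷ [])
    leaves-nonzero = v≢0 ∘ sym ∷ w≢0 ∘ sym ∷ x≢0 ∘ sym ∷ y≢0 ∘ sym ∷ []

  oriented-star-out-fork⇎in-fork : Oriented G → ¬ (HasEdge (𝓛 G) tt ⇔ HasEdge (𝓛 G) hh)
  oriented-star-out-fork⇎in-fork oriented out⇔in with star-has-fork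
  ... | inj₁ out = oriented-star-forks-exclusive oriented out (Equivalence.to out⇔in out)
  ... | inj₂ in′ = oriented-star-forks-exclusive oriented (Equivalence.from out⇔in in′) in′

lemmaA3 : {Lv : Set} (G G' : NLDigraph Lv) →
    WeaklyConnected G → Simple G → Oriented G →
    WeaklyConnected G' → Simple G' → Oriented G' →
    S G ≅U Δ → S G' ≅U Y →
    ¬ (𝓛 G ≅L 𝓛 G')
lemmaA3 G G' _ simple _ _ _ oriented' G≅Δ G'≅Y L≅L′ =
  oriented-star-out-fork⇎in-fork G' G'≅Y oriented'
    (transfer hh ⇔-∘ (out⇔in ⇔-∘ ⇔-sym (transfer tt)))
  where
  out⇔in : HasEdge (𝓛 G) tt ⇔ HasEdge (𝓛 G) hh
  out⇔in = complete-out-fork⇔in-fork G simple (≅Δ⇒complete G G≅Δ)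

  transfer : (l : ELab) → HasEdge (𝓛 G) l ⇔ HasEdge (𝓛 G') l
  transfer = ≅L⇒HasEdge⇔ {H = 𝓛 G} {𝓛 G'} L≅L′
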